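{- Let $k\geq 3$ and let $n:=|V(\mathsf{B}_k)|=4k-3$. Then there exists a vector $\vec x\in\mathbb{R}^n$ satisfying $$\vec 1^\top\vec x=1,\qquad D\vec x=\frac{(-3)^k+4k-1}{8}\,\vec 1,$$ where $D$ is the distance matrix of $\mathsf{B}_k$.
   Context: For a connected graph with vertices $v_1,\dots,v_n$, the distance matrix is $D=(d(v_i,v_j))_{i,j}$ with $d$ the shortest-path distance; $\vec 1$ is the all-ones vector. Let $\mathsf{P}_m$ denote the path on $m$ vertices. The $k$-th basket graph $\mathsf{B}_k$ is obtained by taking disjoint copies of $\mathsf{P}_k,\mathsf{P}_{k+1},\mathsf{P}_{k+1},\mathsf{P}_{k+1}$ and identifying one endpoint of each of the four paths into a single vertex and the other endpoints of each into a second single vertex (creating two vertices of degree four). -}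

module Defs where

open import Data.Nat using (ℕ; zero; suc; _+_; _*_; _∸_; _≤_)
open import Data.Integer as ℤ using (ℤ; +_; -[1+_])
open import Data.Rational as ℚ using (ℚ)
open import Data.Fin using (Fin; zero; suc; toℕ)
open import Data.List using (List; []; _∷_; _++_; map; upTo)
open import Data.List.Membership.Propositional using (_∈_)
open import Data.Product using (_×_; _,_)
open import Data.Sum using (_⊎_)

-- Vertex labelling of the basket graph B_k (vertices are the naturals 0 … 4k-4):
--   0 and 1 are the two degree-four vertices a and b;
--   the path P_k is  a, 2, 3, …, k-1, b        (k-2 internal vertices);
--   the j-th P_{k+1} (j = 0,1,2) is  a, s, s+1, …, s+k-2, b
--   with s = k + j(k-1)                         (k-1 internal vertices each).

pathEdges : List ℕ → List (ℕ × ℕ)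
pathEdges []           = []
pathEdges (u ∷ [])     = []
pathEdges (u ∷ v ∷ vs) = (u , v) ∷ pathEdges (v ∷ vs)

arm : (s m : ℕ) → List ℕ
arm s m = 0 ∷ (map (λ i → s + i) (upTo m) ++ (1 ∷ []))

basketEdges : ℕ → List (ℕ × ℕ)
basketEdges k =
  pathEdges (arm 2 (k ∸ 2)) ++
  pathEdges (arm k (k ∸ 1)) ++
  pathEdges (arm (k + (k ∸ 1)) (k ∸ 1)) ++
  pathEdges (arm (k + 2 * (k ∸ 1)) (k ∸ 1))

basketSize : ℕ → ℕ
basketSize k = 4 * k ∸ 3

Adj : ℕ → ℕ → ℕ → Set
Adj k u v = ((u , v) ∈ basketEdges k) ⊎ ((v , u) ∈ basketEdges k)

data Walk (k : ℕ) : ℕ → ℕ → ℕ → Set where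
  here : ∀ {u} → Walk k u u 0
  step : ∀ {u v w m} → Adj k u v → Walk k v w m → Walk k u w (suc m)

IsDist : ℕ → ℕ → ℕ → ℕ → Set
IsDist k u v d = Walk k u v d × (∀ m → Walk k u v m → d ≤ m)

sumFin : ∀ {n} → (Fin n → ℚ) → ℚ
sumFin {zero}  f = ℚ.0ℚ
sumFin {suc n} f = f zero ℚ.+ sumFin (λ i → f (suc i))

basketConst : ℕ → ℚ
basketConst k = ((-[1+ 2 ] ℤ.^ k) ℤ.+ (+ (4 * k)) ℤ.- (+ 1)) ℚ./ 8

module Submission where

-- Write ν i = (-3)^i. Number the vertices of each path of B_k from both ends, u + v constant: the path P_k
-- between the two hubs a, b with both hubs, each P_(k+1) without them. A vertex gets the weight ν u + ν v,
-- and x is half of the weight; the geometric series gives Σ x = 1. Seen from a fixed vertex, the distance to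
-- the vertices of its own path is |t - u|, and to those of any other path it is min(α + u, β + v), the two
-- routes through a and through b. Splitting at the crossover, every path contributes two sums of an affine
-- function of u times ν u or ν v, and their closed forms add up to ((-3)^k + 4k - 1)/8 for every vertex.
-- These formulas are the graph distances: explicit walks realise them, and they change by at most one
-- along every edge.

open import Data.Nat as ℕ using (ℕ; zero; suc; _∸_; _⊓_; _≤_; _<_; z≤n; s≤s; ∣_-_∣; _<?_)
import Data.Nat.Properties as ℕP
open import Data.Nat.Tactic.RingSolver using () renaming (solve-∀ to ℕ-solve-∀)
open import Data.Integer as ℤ using (ℤ; +_; -[1+_])
import Data.Integer.Properties as ℤP
open import Data.Integer.Tactic.RingSolver using (solve-∀)
open import Data.Rational as ℚ using (ℚ; 1ℚ; _/_; fromℚᵘ)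
open import Data.Rational.Properties using (fromℚᵘ-toℚᵘ; toℚᵘ-fromℚᵘ; fromℚᵘ-cong; toℚᵘ-homo-+; toℚᵘ-homo-*)
open import Data.Rational.Unnormalised as ℚᵘ using (mkℚᵘ; *≡*)
import Data.Rational.Unnormalised.Properties as ℚᵘP
open import Data.Fin using (Fin; zero; suc; toℕ)
open import Data.Fin.Properties using (_≟_; toℕ<n)
open import Data.Bool using (false; if_then_else_)
open import Data.List using ([]; _∷_; _++_; map; applyUpTo; upTo)
open import Data.List.Membership.Propositional using (_∈_)
open import Data.List.Membership.Propositional.Properties using (∈-++⁻; ∈-++⁺ˡ; ∈-++⁺ʳ)
open import Data.List.Relation.Unary.Any using (here; there)
open import Data.Product using (Σ; _×_; _,_; proj₁; proj₂)
open import Data.Sum using (_⊎_; inj₁; inj₂)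
open import Function using (_∘_)
open import Relation.Nullary using (does; yes; no)
open import Relation.Nullary.Decidable using (dec-true; dec-false)
open import Relation.Binary.PropositionalEquality
open import Defs

split-< : ∀ a {b ℓ} → ℓ < a ℕ.+ b → ℓ < a ⊎ Σ ℕ λ r → r < b × a ℕ.+ r ≡ ℓ
split-< a {b} {ℓ} ℓ<a+b with ℓ <? a
... | yes ℓ<a = inj₁ ℓ<a
... | no  ℓ≮a = inj₂ (ℓ ∸ a , ℕP.+-cancelˡ-< a _ _ (subst (_< a ℕ.+ b) (sym a+r≡ℓ) ℓ<a+b) , a+r≡ℓ)
  where a+r≡ℓ = ℕP.m+[n∸m]≡n (ℕP.≮⇒≥ ℓ≮a)

Near : ℕ → ℕ → Set
Near a b = a ≤ suc b × b ≤ suc a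

near-sym : ∀ {a b} → Near a b → Near b a
near-sym (a≤ , b≤) = b≤ , a≤

near-refl : ∀ a → Near a a
near-refl a = ℕP.n≤1+n a , ℕP.n≤1+n a

near-suc : ∀ a → Near a (suc a)
near-suc a = ℕP.m≤n⇒m≤1+n (ℕP.n≤1+n a) , ℕP.≤-refl

near-+ˡ : ∀ c {a b} → Near a b → Near (c ℕ.+ a) (c ℕ.+ b)
near-+ˡ c {a} {b} (a≤ , b≤) =
  ℕP.≤-trans (ℕP.+-monoʳ-≤ c a≤) (ℕP.≤-reflexive (ℕP.+-suc c b)) ,
  ℕP.≤-trans (ℕP.+-monoʳ-≤ c b≤) (ℕP.≤-reflexive (ℕP.+-suc c a))

near-+ʳ : ∀ c {a b} → Near a b → Near (a ℕ.+ c) (b ℕ.+ c)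
near-+ʳ c {a} {b} = subst₂ Near (ℕP.+-comm c a) (ℕP.+-comm c b) ∘ near-+ˡ c

near-⊓ : ∀ {a a′ b b′} → Near a a′ → Near b b′ → Near (a ⊓ b) (a′ ⊓ b′)
near-⊓ {a} {a′} {b} {b′} (a≤ , a′≤) (b≤ , b′≤) =
  ℕP.⊓-glb (ℕP.≤-trans (ℕP.m⊓n≤m a b) a≤) (ℕP.≤-trans (ℕP.m⊓n≤n a b) b≤) ,
  ℕP.⊓-glb (ℕP.≤-trans (ℕP.m⊓n≤m a′ b′) a′≤) (ℕP.≤-trans (ℕP.m⊓n≤n a′ b′) b′≤)

near-∸ : ∀ a t → Near (a ∸ t) (a ∸ suc t)
near-∸ zero    zero    = near-refl 0
near-∸ zero    (suc t) = near-refl 0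
near-∸ (suc a) zero    = near-sym (near-suc a)
near-∸ (suc a) (suc t) = near-∸ a t

near-∣-∣ : ∀ t u → Near ∣ t - u ∣ ∣ suc t - u ∣
near-∣-∣ zero    zero    = near-suc 0
near-∣-∣ zero    (suc u) = near-sym (near-suc u)
near-∣-∣ (suc t) zero    = near-suc (suc t)
near-∣-∣ (suc t) (suc u) = near-∣-∣ t u

≡⇒near : ∀ {a b} → a ≡ b → Near a b
≡⇒near {a} refl = near-refl a

near-⊓-suc : ∀ {a b} → a ≤ b → Near a (suc a ⊓ b)
near-⊓-suc {a} {b} a≤b = ℕP.m≤n⇒m≤1+n (ℕP.⊓-glb (ℕP.n≤1+n a) a≤b) , ℕP.m⊓n≤m (suc a) b

-- The integer operators are opened only locally: the statement of the theorem uses the rational _*_.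
module _ where
  open import Data.Integer using (_+_; _*_; _-_; _^_)

  ν : ℕ → ℤ
  ν n = -[1+ 2 ] ^ n

  ν-+ : ∀ m n → ν (m ℕ.+ n) ≡ ν m * ν n
  ν-+ = ℤP.^-distribˡ-+-* -[1+ 2 ]

  -- Σ⟨ L ⟩ F sums F u v over the L pairs with u + v = L - 1.
  Σ⟨_⟩_ : ℕ → (ℕ → ℕ → ℤ) → ℤ
  Σ⟨ zero  ⟩ F = + 0
  Σ⟨ suc L ⟩ F = F 0 L + Σ⟨ L ⟩ λ u v → F (suc u) v

  Σ-cong : ∀ L {F G : ℕ → ℕ → ℤ} → (∀ u v → suc (u ℕ.+ v) ≡ L → F u v ≡ G u v) →
           Σ⟨ L ⟩ F ≡ Σ⟨ L ⟩ G
  Σ-cong zero    F≡G = refl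
  Σ-cong (suc L) F≡G = cong₂ _+_ (F≡G 0 L refl) (Σ-cong L λ u v eq → F≡G (suc u) v (cong suc eq))

  Σ-+ : ∀ L (F G : ℕ → ℕ → ℤ) → Σ⟨ L ⟩ (λ u v → F u v + G u v) ≡ Σ⟨ L ⟩ F + Σ⟨ L ⟩ G
  Σ-+ zero    F G = refl
  Σ-+ (suc L) F G = trans (cong (_+_ (F 0 L + G 0 L)) (Σ-+ L _ _)) (interchange (F 0 L) (G 0 L) _ _)
    where
    interchange : ∀ a b c d → (a + b) + (c + d) ≡ (a + c) + (b + d)
    interchange = solve-∀

  Σ-*ˡ : ∀ L c (F : ℕ → ℕ → ℤ) → Σ⟨ L ⟩ (λ u v → c * F u v) ≡ c * Σ⟨ L ⟩ F
  Σ-*ˡ zero    c F = sym (ℤP.*-zeroʳ c)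
  Σ-*ˡ (suc L) c F = trans (cong (_+_ (c * F 0 L)) (Σ-*ˡ L c _)) (sym (ℤP.*-distribˡ-+ c (F 0 L) _))

  Σ-snoc : ∀ L F → Σ⟨ suc L ⟩ F ≡ Σ⟨ L ⟩ (λ u v → F u (suc v)) + F L 0
  Σ-snoc zero    F = ℤP.+-comm (F 0 0) (+ 0)
  Σ-snoc (suc L) F = trans (cong (_+_ (F 0 (suc L))) (Σ-snoc L λ u v → F (suc u) v)) (sym (ℤP.+-assoc (F 0 (suc L)) _ _))

  Σ-++ : ∀ L₁ L₂ F →
         Σ⟨ L₁ ℕ.+ L₂ ⟩ F ≡ Σ⟨ L₁ ⟩ (λ u v → F u (v ℕ.+ L₂)) + Σ⟨ L₂ ⟩ (λ u v → F (u ℕ.+ L₁) v)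
  Σ-++ zero     L₂ F = sym (trans (ℤP.+-identityˡ _) (Σ-cong L₂ λ u v _ → cong (λ w → F w v) (ℕP.+-identityʳ u)))
  Σ-++ (suc L₁) L₂ F = begin
    F 0 (L₁ ℕ.+ L₂) + Σ⟨ L₁ ℕ.+ L₂ ⟩ (λ u v → F (suc u) v)
      ≡⟨ cong (_+_ (F 0 (L₁ ℕ.+ L₂))) (Σ-++ L₁ L₂ _) ⟩
    F 0 (L₁ ℕ.+ L₂) + (Σ⟨ L₁ ⟩ (λ u v → F (suc u) (v ℕ.+ L₂)) + Σ⟨ L₂ ⟩ (λ u v → F (suc (u ℕ.+ L₁)) v))
      ≡⟨ sym (ℤP.+-assoc (F 0 (L₁ ℕ.+ L₂)) _ _) ⟩
    Σ⟨ suc L₁ ⟩ (λ u v → F u (v ℕ.+ L₂)) + Σ⟨ L₂ ⟩ (λ u v → F (suc (u ℕ.+ L₁)) v)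
      ≡⟨ cong (_+_ (Σ⟨ suc L₁ ⟩ λ u v → F u (v ℕ.+ L₂)))
              (Σ-cong L₂ λ u v _ → cong (λ w → F w v) (sym (ℕP.+-suc u L₁))) ⟩
    Σ⟨ suc L₁ ⟩ (λ u v → F u (v ℕ.+ L₂)) + Σ⟨ L₂ ⟩ (λ u v → F (u ℕ.+ suc L₁) v) ∎
    where open ≡-Reasoning

  Σ-swap : ∀ L F → Σ⟨ L ⟩ F ≡ Σ⟨ L ⟩ (λ u v → F v u)
  Σ-swap zero    F = refl
  Σ-swap (suc L) F = begin
    F 0 L + Σ⟨ L ⟩ (λ u v → F (suc u) v)  ≡⟨ cong (_+_ (F 0 L)) (Σ-swap L _) ⟩
    F 0 L + Σ⟨ L ⟩ (λ u v → F (suc v) u)  ≡⟨ ℤP.+-comm (F 0 L) _ ⟩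
    Σ⟨ L ⟩ (λ u v → F (suc v) u) + F 0 L  ≡⟨ sym (Σ-snoc L (λ u v → F v u)) ⟩
    Σ⟨ suc L ⟩ (λ u v → F v u)            ∎
    where open ≡-Reasoning

  Σ-complement : ∀ L (F : ℕ → ℕ → ℤ) → Σ⟨ suc L ⟩ (λ u _ → F u (L ∸ u)) ≡ Σ⟨ suc L ⟩ F
  Σ-complement L F = Σ-cong (suc L) λ u v eq →
    cong (F u) (trans (cong (_∸ u) (ℕP.suc-injective (sym eq))) (ℕP.m+n∸m≡n u v))

  Σ-blocks : ∀ a b (f : ℕ → ℤ) →
             Σ⟨ a ℕ.+ b ⟩ (λ ℓ _ → f ℓ) ≡ Σ⟨ a ⟩ (λ ℓ _ → f ℓ) + Σ⟨ b ⟩ (λ r _ → f (a ℕ.+ r))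
  Σ-blocks a b f = trans (Σ-++ a b (λ ℓ _ → f ℓ))
                         (cong (_+_ (Σ⟨ a ⟩ λ ℓ _ → f ℓ)) (Σ-cong b λ r _ _ → cong f (ℕP.+-comm r a)))

  Σ-geometric : ∀ L → + 4 * Σ⟨ L ⟩ (λ u v → ν u) ≡ + 1 - ν L
  Σ-geometric zero    = refl
  Σ-geometric (suc L) = begin
    + 4 * Σ⟨ suc L ⟩ (λ u v → ν u)         ≡⟨ cong (+ 4 *_) (Σ-snoc L (λ u v → ν u)) ⟩
    + 4 * (Σ⟨ L ⟩ (λ u v → ν u) + ν L)     ≡⟨ ℤP.*-distribˡ-+ (+ 4) (Σ⟨ L ⟩ λ u v → ν u) (ν L) ⟩
    + 4 * Σ⟨ L ⟩ (λ u v → ν u) + + 4 * ν L ≡⟨ cong (_+ + 4 * ν L) (Σ-geometric L) ⟩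
    + 1 - ν L + + 4 * ν L                  ≡⟨ recurrence (ν L) ⟩
    + 1 - ν (suc L)                        ∎
    where
    open ≡-Reasoning
    recurrence : ∀ x → + 1 - x + + 4 * x ≡ + 1 - -[1+ 2 ] * x
    recurrence = solve-∀

  Σ-affine-geometric : ∀ L α β γ →
    + 16 * Σ⟨ L ⟩ (λ u v → (α + β * + u + γ * + v) * ν u)
      ≡ α * (+ 4 - + 4 * ν L) + β * ((+ 3 - + 4 * + L) * ν L - + 3) + γ * (+ 4 * + L - + 1 + ν L)
  Σ-affine-geometric zero    α β γ = zero-case α β γ
    where
    zero-case : ∀ α β γ → + 16 * + 0 ≡ α * (+ 4 - + 4 * + 1) + β * ((+ 3 - + 4 * + 0) * + 1 - + 3) + γ * (+ 4 * + 0 - + 1 + + 1)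
    zero-case = solve-∀
  Σ-affine-geometric (suc L) α β γ = begin
    + 16 * Σ⟨ suc L ⟩ F
      ≡⟨ cong (+ 16 *_) (Σ-snoc L F) ⟩
    + 16 * (Σ⟨ L ⟩ (λ u v → F u (suc v)) + F L 0)
      ≡⟨ cong (λ s → + 16 * (s + F L 0)) (Σ-cong L λ u v _ → shift α β γ (+ u) (+ v) (ν u)) ⟩
    + 16 * (Σ⟨ L ⟩ (λ u v → (α + γ + β * + u + γ * + v) * ν u) + F L 0)
      ≡⟨ ℤP.*-distribˡ-+ (+ 16) (Σ⟨ L ⟩ λ u v → (α + γ + β * + u + γ * + v) * ν u) (F L 0) ⟩
    + 16 * Σ⟨ L ⟩ (λ u v → (α + γ + β * + u + γ * + v) * ν u) + + 16 * F L 0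
      ≡⟨ cong (_+ + 16 * F L 0) (Σ-affine-geometric L (α + γ) β γ) ⟩
    (α + γ) * (+ 4 - + 4 * ν L) + β * ((+ 3 - + 4 * + L) * ν L - + 3) + γ * (+ 4 * + L - + 1 + ν L) + + 16 * F L 0
      ≡⟨ recurrence α β γ (+ L) (ν L) ⟩
    α * (+ 4 - + 4 * ν (suc L)) + β * ((+ 3 - + 4 * + suc L) * ν (suc L) - + 3) + γ * (+ 4 * + suc L - + 1 + ν (suc L)) ∎
    where
    open ≡-Reasoning
    F : ℕ → ℕ → ℤ
    F u v = (α + β * + u + γ * + v) * ν u
    shift : ∀ α β γ u v x → (α + β * u + γ * (+ 1 + v)) * x ≡ (α + γ + β * u + γ * v) * x
    shift = solve-∀
    recurrence : ∀ α β γ l x →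
      (α + γ) * (+ 4 - + 4 * x) + β * ((+ 3 - + 4 * l) * x - + 3) + γ * (+ 4 * l - + 1 + x) + + 16 * ((α + β * l + γ * + 0) * x)
        ≡ α * (+ 4 - + 4 * (-[1+ 2 ] * x)) + β * ((+ 3 - + 4 * (+ 1 + l)) * (-[1+ 2 ] * x) - + 3)
          + γ * (+ 4 * (+ 1 + l) - + 1 + -[1+ 2 ] * x)
    recurrence = solve-∀

  Σ-symmetric-geometric : ∀ L → + 4 * Σ⟨ L ⟩ (λ u v → ν u + ν v) ≡ + 2 * (+ 1 - ν L)
  Σ-symmetric-geometric L = begin
    + 4 * Σ⟨ L ⟩ (λ u v → ν u + ν v)
      ≡⟨ cong (+ 4 *_) (trans (Σ-+ L (λ u v → ν u) (λ u v → ν v))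
                              (cong (_+_ (Σ⟨ L ⟩ λ u v → ν u)) (sym (Σ-swap L λ u v → ν u)))) ⟩
    + 4 * (Σ⟨ L ⟩ (λ u v → ν u) + Σ⟨ L ⟩ (λ u v → ν u))
      ≡⟨ double (Σ⟨ L ⟩ λ u v → ν u) ⟩
    + 2 * (+ 4 * Σ⟨ L ⟩ (λ u v → ν u))
      ≡⟨ cong (+ 2 *_) (Σ-geometric L) ⟩
    + 2 * (+ 1 - ν L) ∎
    where
    open ≡-Reasoning
    double : ∀ s → + 4 * (s + s) ≡ + 2 * (+ 4 * s)
    double = solve-∀

  Σ-affine-two-sided : ∀ L c a b →
    + 16 * Σ⟨ L ⟩ (λ u v → (c + + u) * (a * ν u + b * ν v))
      ≡ a * (+ 4 * c * (+ 1 - ν L) + (+ 3 - + 4 * + L) * ν L - + 3) + b * (+ 4 * c * (+ 1 - ν L) + + 4 * + L - + 1 + ν L)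
  Σ-affine-two-sided L c a b = begin
    + 16 * Σ⟨ L ⟩ (λ u v → (c + + u) * (a * ν u + b * ν v))
      ≡⟨ cong (+ 16 *_) (Σ-cong L λ u v _ → split c a b (+ u) (+ v) (ν u) (ν v)) ⟩
    + 16 * Σ⟨ L ⟩ (λ u v → a * Fᵘ u v + b * Fᵛ u v)
      ≡⟨ cong (+ 16 *_) (trans (Σ-+ L _ _) (cong₂ _+_ (Σ-*ˡ L a Fᵘ) (Σ-*ˡ L b Fᵛ))) ⟩
    + 16 * (a * Σ⟨ L ⟩ Fᵘ + b * Σ⟨ L ⟩ Fᵛ)
      ≡⟨ cong (λ s → + 16 * (a * Σ⟨ L ⟩ Fᵘ + b * s)) (Σ-swap L Fᵛ) ⟩
    + 16 * (a * Σ⟨ L ⟩ Fᵘ + b * Σ⟨ L ⟩ (λ u v → Fᵛ v u))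
      ≡⟨ distribute a b (Σ⟨ L ⟩ Fᵘ) (Σ⟨ L ⟩ λ u v → Fᵛ v u) ⟩
    a * (+ 16 * Σ⟨ L ⟩ Fᵘ) + b * (+ 16 * Σ⟨ L ⟩ (λ u v → Fᵛ v u))
      ≡⟨ cong₂ (λ s s′ → a * s + b * s′) (Σ-affine-geometric L c (+ 1) (+ 0)) (Σ-affine-geometric L c (+ 0) (+ 1)) ⟩
    a * (c * (+ 4 - + 4 * ν L) + + 1 * ((+ 3 - + 4 * + L) * ν L - + 3) + + 0 * (+ 4 * + L - + 1 + ν L))
      + b * (c * (+ 4 - + 4 * ν L) + + 0 * ((+ 3 - + 4 * + L) * ν L - + 3) + + 1 * (+ 4 * + L - + 1 + ν L))
      ≡⟨ simplify a b c (+ L) (ν L) ⟩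
    a * (+ 4 * c * (+ 1 - ν L) + (+ 3 - + 4 * + L) * ν L - + 3) + b * (+ 4 * c * (+ 1 - ν L) + + 4 * + L - + 1 + ν L) ∎
    where
    open ≡-Reasoning
    Fᵘ Fᵛ : ℕ → ℕ → ℤ
    Fᵘ u v = (c + + 1 * + u + + 0 * + v) * ν u
    Fᵛ u v = (c + + 0 * + v + + 1 * + u) * ν v
    split : ∀ c a b u v x y → (c + u) * (a * x + b * y) ≡ a * ((c + + 1 * u + + 0 * v) * x) + b * ((c + + 0 * v + + 1 * u) * y)
    split = solve-∀
    distribute : ∀ a b s s′ → + 16 * (a * s + b * s′) ≡ a * (+ 16 * s) + b * (+ 16 * s′)
    distribute = solve-∀
    simplify : ∀ a b c l z →
      a * (c * (+ 4 - + 4 * z) + + 1 * ((+ 3 - + 4 * l) * z - + 3) + + 0 * (+ 4 * l - + 1 + z))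
        + b * (c * (+ 4 - + 4 * z) + + 0 * ((+ 3 - + 4 * l) * z - + 3) + + 1 * (+ 4 * l - + 1 + z))
        ≡ a * (+ 4 * c * (+ 1 - z) + (+ 3 - + 4 * l) * z - + 3) + b * (+ 4 * c * (+ 1 - z) + + 4 * l - + 1 + z)
    simplify = solve-∀

  private
    segment-bound : ∀ a b x y L → a ℕ.+ suc (x ℕ.+ y) ≤ suc (b ℕ.+ L) → a ℕ.+ x ≤ b ℕ.+ (y ℕ.+ L)
    segment-bound a b x y L h = begin
      a ℕ.+ x          ≤⟨ ℕP.+-monoʳ-≤ a (ℕP.m≤m+n x y) ⟩
      a ℕ.+ (x ℕ.+ y)  ≤⟨ ℕP.≤-pred (ℕP.≤-trans (ℕP.≤-reflexive (sym (ℕP.+-suc a (x ℕ.+ y)))) h) ⟩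
      b ℕ.+ L          ≤⟨ ℕP.+-monoʳ-≤ b (ℕP.m≤n+m L y) ⟩
      b ℕ.+ (y ℕ.+ L)  ∎
      where open ℕP.≤-Reasoning

  Σ-⊓-closed-form : ∀ α β L₁ L₂ → Near (α ℕ.+ L₁) (β ℕ.+ L₂) →
    + 16 * Σ⟨ L₁ ℕ.+ L₂ ⟩ (λ u v → + ((α ℕ.+ u) ⊓ (β ℕ.+ v)) * (ν u + ν v))
      ≡ + 4 * + α * ((+ 1 - ν L₁) * (+ 1 + ν L₂)) + + 4 * + β * ((+ 1 + ν L₁) * (+ 1 - ν L₂))
        + + 2 * (ν L₁ + ν L₂ + ν L₁ * ν L₂ - + 3) + + 4 * (+ L₂ - + L₁) * (ν L₁ - ν L₂)
  -- Near puts the crossover of the two affine functions right after the first L₁ terms.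
  Σ-⊓-closed-form α β L₁ L₂ (h₁ , h₂) = begin
    + 16 * Σ⟨ L₁ ℕ.+ L₂ ⟩ F
      ≡⟨ cong (+ 16 *_) (Σ-++ L₁ L₂ F) ⟩
    + 16 * (Σ⟨ L₁ ⟩ (λ u v → F u (v ℕ.+ L₂)) + Σ⟨ L₂ ⟩ (λ u v → F (u ℕ.+ L₁) v))
      ≡⟨ cong (+ 16 *_) (cong₂ _+_ (Σ-cong L₁ before) (trans (Σ-cong L₂ after) (Σ-swap L₂ λ u v → F₂ v u))) ⟩
    + 16 * (Σ⟨ L₁ ⟩ F₁ + Σ⟨ L₂ ⟩ F₂)
      ≡⟨ ℤP.*-distribˡ-+ (+ 16) (Σ⟨ L₁ ⟩ F₁) (Σ⟨ L₂ ⟩ F₂) ⟩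
    + 16 * Σ⟨ L₁ ⟩ F₁ + + 16 * Σ⟨ L₂ ⟩ F₂
      ≡⟨ cong₂ _+_ (Σ-affine-two-sided L₁ (+ α) (+ 1) (ν L₂)) (Σ-affine-two-sided L₂ (+ β) (+ 1) (ν L₁)) ⟩
    _
      ≡⟨ combine (+ α) (+ β) (+ L₁) (+ L₂) (ν L₁) (ν L₂) ⟩
    _ ∎
    where
    open ≡-Reasoning
    F F₁ F₂ : ℕ → ℕ → ℤ
    F u v = + ((α ℕ.+ u) ⊓ (β ℕ.+ v)) * (ν u + ν v)
    F₁ u v = (+ α + + u) * (+ 1 * ν u + ν L₂ * ν v)
    F₂ u v = (+ β + + u) * (+ 1 * ν u + ν L₁ * ν v)
    before : ∀ u v → suc (u ℕ.+ v) ≡ L₁ → F u (v ℕ.+ L₂) ≡ F₁ u v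
    before u v refl = begin
      + ((α ℕ.+ u) ⊓ (β ℕ.+ (v ℕ.+ L₂))) * (ν u + ν (v ℕ.+ L₂))
        ≡⟨ cong₂ (λ d w → + d * (ν u + w)) (ℕP.m≤n⇒m⊓n≡m (segment-bound α β u v L₂ h₁)) (ν-+ v L₂) ⟩
      + (α ℕ.+ u) * (ν u + ν v * ν L₂)
        ≡⟨ cong (_* (ν u + ν v * ν L₂)) (ℤP.pos-+ α u) ⟩
      (+ α + + u) * (ν u + ν v * ν L₂)
        ≡⟨ cong ((+ α + + u) *_) (cong₂ _+_ (sym (ℤP.*-identityˡ (ν u))) (ℤP.*-comm (ν v) (ν L₂))) ⟩
      F₁ u v ∎
    after : ∀ u v → suc (u ℕ.+ v) ≡ L₂ → F (u ℕ.+ L₁) v ≡ F₂ v u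
    after u v refl = begin
      + ((α ℕ.+ (u ℕ.+ L₁)) ⊓ (β ℕ.+ v)) * (ν (u ℕ.+ L₁) + ν v)
        ≡⟨ cong₂ (λ d w → + d * (w + ν v)) (ℕP.m≥n⇒m⊓n≡n (segment-bound β α v u L₁ h₂′)) (ν-+ u L₁) ⟩
      + (β ℕ.+ v) * (ν u * ν L₁ + ν v)
        ≡⟨ cong (_* (ν u * ν L₁ + ν v)) (ℤP.pos-+ β v) ⟩
      (+ β + + v) * (ν u * ν L₁ + ν v)
        ≡⟨ cong ((+ β + + v) *_) (trans (ℤP.+-comm (ν u * ν L₁) (ν v))
                                       (cong₂ _+_ (sym (ℤP.*-identityˡ (ν v))) (ℤP.*-comm (ν u) (ν L₁)))) ⟩
      F₂ v u ∎
      where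
      h₂′ : β ℕ.+ suc (v ℕ.+ u) ≤ suc (α ℕ.+ L₁)
      h₂′ = subst (λ s → β ℕ.+ suc s ≤ suc (α ℕ.+ L₁)) (ℕP.+-comm u v) h₂
    combine : ∀ a b l₁ l₂ x y →
      + 1 * (+ 4 * a * (+ 1 - x) + (+ 3 - + 4 * l₁) * x - + 3) + y * (+ 4 * a * (+ 1 - x) + + 4 * l₁ - + 1 + x)
        + (+ 1 * (+ 4 * b * (+ 1 - y) + (+ 3 - + 4 * l₂) * y - + 3) + x * (+ 4 * b * (+ 1 - y) + + 4 * l₂ - + 1 + y))
        ≡ + 4 * a * ((+ 1 - x) * (+ 1 + y)) + + 4 * b * ((+ 1 + x) * (+ 1 - y))
          + + 2 * (x + y + x * y - + 3) + + 4 * (l₂ - l₁) * (x - y)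
    combine = solve-∀

  Σ-∣-∣-closed-form : ∀ t t′ →
    + 16 * Σ⟨ suc (t ℕ.+ t′) ⟩ (λ u v → + ∣ t - u ∣ * (ν u + ν v))
      ≡ + 6 * ((+ 1 - ν t) * (+ 1 - ν t′)) + + 4 * (+ t + + t′) * (+ 1 + + 3 * (ν t * ν t′))
  Σ-∣-∣-closed-form t t′ = begin
    + 16 * Σ⟨ suc t ℕ.+ t′ ⟩ F
      ≡⟨ cong (+ 16 *_) (Σ-++ (suc t) t′ F) ⟩
    + 16 * (Σ⟨ suc t ⟩ (λ u v → F u (v ℕ.+ t′)) + Σ⟨ t′ ⟩ (λ u v → F (u ℕ.+ suc t) v))
      ≡⟨ cong (+ 16 *_) (cong₂ _+_ (trans (Σ-cong (suc t) before) (Σ-swap (suc t) λ u v → F₁ v u)) (Σ-cong t′ after)) ⟩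
    + 16 * (Σ⟨ suc t ⟩ F₁ + Σ⟨ t′ ⟩ F₂)
      ≡⟨ ℤP.*-distribˡ-+ (+ 16) (Σ⟨ suc t ⟩ F₁) (Σ⟨ t′ ⟩ F₂) ⟩
    + 16 * Σ⟨ suc t ⟩ F₁ + + 16 * Σ⟨ t′ ⟩ F₂
      ≡⟨ cong₂ _+_ (Σ-affine-two-sided (suc t) (+ 0) (ν t′) (+ 1)) (Σ-affine-two-sided t′ (+ 1) (ν (suc t)) (+ 1)) ⟩
    _
      ≡⟨ combine (+ t) (+ t′) (ν t) (ν t′) ⟩
    _ ∎
    where
    open ≡-Reasoning
    F F₁ F₂ : ℕ → ℕ → ℤ
    F u v = + ∣ t - u ∣ * (ν u + ν v)
    F₁ u v = (+ 0 + + u) * (ν t′ * ν u + + 1 * ν v)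
    F₂ u v = (+ 1 + + u) * (ν (suc t) * ν u + + 1 * ν v)
    before : ∀ u v → suc (u ℕ.+ v) ≡ suc t → F u (v ℕ.+ t′) ≡ F₁ v u
    before u v refl = begin
      + ∣ u ℕ.+ v - u ∣ * (ν u + ν (v ℕ.+ t′))
        ≡⟨ cong₂ (λ d w → + d * (ν u + w)) (trans (ℕP.∣-∣-comm (u ℕ.+ v) u) (ℕP.∣m-m+n∣≡n u v)) (ν-+ v t′) ⟩
      + v * (ν u + ν v * ν t′)
        ≡⟨ reorder (+ v) (ν u) (ν v) (ν t′) ⟩
      F₁ v u ∎
      where
      reorder : ∀ d x y z → d * (x + y * z) ≡ (+ 0 + d) * (z * y + + 1 * x)
      reorder = solve-∀
    after : ∀ u v → suc (u ℕ.+ v) ≡ t′ → F (u ℕ.+ suc t) v ≡ F₂ u v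
    after u v _ = begin
      + ∣ t - u ℕ.+ suc t ∣ * (ν (u ℕ.+ suc t) + ν v)
        ≡⟨ cong₂ (λ d w → + d * (w + ν v))
                 (trans (cong ∣ t -_∣ (u+1+t≡t+1+u)) (ℕP.∣m-m+n∣≡n t (suc u))) (ν-+ u (suc t)) ⟩
      + suc u * (ν u * ν (suc t) + ν v)
        ≡⟨ reorder (+ u) (ν u) (ν (suc t)) (ν v) ⟩
      F₂ u v ∎
      where
      u+1+t≡t+1+u : u ℕ.+ suc t ≡ t ℕ.+ suc u
      u+1+t≡t+1+u = trans (ℕP.+-comm u (suc t)) (sym (ℕP.+-suc t u))
      reorder : ∀ d x y z → (+ 1 + d) * (x * y + z) ≡ (+ 1 + d) * (y * x + + 1 * z)
      reorder = solve-∀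
    combine : ∀ t t′ x y →
      y * (+ 4 * + 0 * (+ 1 - -[1+ 2 ] * x) + (+ 3 - + 4 * (+ 1 + t)) * (-[1+ 2 ] * x) - + 3)
        + + 1 * (+ 4 * + 0 * (+ 1 - -[1+ 2 ] * x) + + 4 * (+ 1 + t) - + 1 + -[1+ 2 ] * x)
        + ((-[1+ 2 ] * x) * (+ 4 * + 1 * (+ 1 - y) + (+ 3 - + 4 * t′) * y - + 3)
           + + 1 * (+ 4 * + 1 * (+ 1 - y) + + 4 * t′ - + 1 + y))
        ≡ + 6 * ((+ 1 - x) * (+ 1 - y)) + + 4 * (t + t′) * (+ 1 + + 3 * (x * y))
    combine = solve-∀

map-applyUpTo : ∀ (f h : ℕ → ℕ) M → map f (applyUpTo h M) ≡ applyUpTo (f ∘ h) M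
map-applyUpTo f h zero    = refl
map-applyUpTo f h (suc M) = cong (f (h 0) ∷_) (map-applyUpTo f (h ∘ suc) M)

data SegmentEdge (h : ℕ → ℕ) (M z : ℕ) : ℕ × ℕ → Set where
  inner : ∀ {i} → i < M → SegmentEdge h M z (h i , h (suc i))
  last  : SegmentEdge h M z (h M , z)

segment-edge⁻ : ∀ h M z {e} → e ∈ pathEdges (applyUpTo h (suc M) ++ z ∷ []) → SegmentEdge h M z e
segment-edge⁻ h zero    z (here refl) = last
segment-edge⁻ h (suc M) z (here refl) = inner (s≤s z≤n)
segment-edge⁻ h (suc M) z (there e∈) with segment-edge⁻ (h ∘ suc) M z e∈
... | inner i<M = inner (s≤s i<M)
... | last      = last

segment-edge⁺ : ∀ h M z {e} → SegmentEdge h M z e → e ∈ pathEdges (applyUpTo h (suc M) ++ z ∷ [])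
segment-edge⁺ h (suc M) z (inner {zero}  _)         = here refl
segment-edge⁺ h (suc M) z (inner {suc i} (s≤s i<M)) = there (segment-edge⁺ (h ∘ suc) M z (inner i<M))
segment-edge⁺ h zero    z last = here refl
segment-edge⁺ h (suc M) z last = there (segment-edge⁺ (h ∘ suc) M z last)

data ArmEdge (s M : ℕ) : ℕ × ℕ → Set where
  first : ArmEdge s M (0 , s ℕ.+ 0)
  inner : ∀ {i} → i < M → ArmEdge s M (s ℕ.+ i , s ℕ.+ suc i)
  last  : ArmEdge s M (s ℕ.+ M , 1)

arm-tail : ∀ s M → pathEdges (map (s ℕ.+_) (upTo (suc M)) ++ 1 ∷ []) ≡ pathEdges (applyUpTo (s ℕ.+_) (suc M) ++ 1 ∷ [])
arm-tail s M = cong (λ xs → pathEdges (xs ++ 1 ∷ [])) (map-applyUpTo (s ℕ.+_) (λ i → i) (suc M))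

arm-edge⁻ : ∀ s M {e} → e ∈ pathEdges (arm s (suc M)) → ArmEdge s M e
arm-edge⁻ s M (here refl) = first
arm-edge⁻ s M {e} (there e∈) with segment-edge⁻ (s ℕ.+_) M 1 (subst (e ∈_) (arm-tail s M) e∈)
... | inner i<M = inner i<M
... | last      = last

arm-edge⁺ : ∀ s M {e} → ArmEdge s M e → e ∈ pathEdges (arm s (suc M))
arm-edge⁺ s M first       = here refl
arm-edge⁺ s M {e} (inner i<M) = there (subst (e ∈_) (sym (arm-tail s M)) (segment-edge⁺ (s ℕ.+_) M 1 (inner i<M)))
arm-edge⁺ s M {e} last        = there (subst (e ∈_) (sym (arm-tail s M)) (segment-edge⁺ (s ℕ.+_) M 1 last))

module _ {k : ℕ} where

  adj-sym : ∀ {a b} → Adj k a b → Adj k b a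
  adj-sym (inj₁ e) = inj₂ e
  adj-sym (inj₂ e) = inj₁ e

  _++ʷ_ : ∀ {a b c L L′} → Walk k a b L → Walk k b c L′ → Walk k a c (L ℕ.+ L′)
  here     ++ʷ q = q
  step e p ++ʷ q = step e (p ++ʷ q)

  reverse : ∀ {a b L} → Walk k a b L → Walk k b a L
  reverse here                = here
  reverse (step {m = L} e p) = subst (Walk k _ _) (ℕP.+-comm L 1) (reverse p ++ʷ step (adj-sym e) here)

  shorter : ∀ {a b L L′} → Walk k a b L → Walk k a b L′ → Walk k a b (L ⊓ L′)
  shorter {L = L} {L′} p q with ℕP.≤-total L L′
  ... | inj₁ L≤L′ = subst (Walk k _ _) (sym (ℕP.m≤n⇒m⊓n≡m L≤L′)) p
  ... | inj₂ L′≤L = subst (Walk k _ _) (sym (ℕP.m≥n⇒m⊓n≡n L′≤L)) q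

module Basket (m : ℕ) where

  k n : ℕ
  k = suc (suc (suc m))
  n = suc (suc m)

  -- short u is the vertex at position u on the path P_k (the hubs are short 0 and short n);
  -- long j p is the vertex at distance p + 1 from short 0 on the j-th path P_{k+1}.
  data Vertex : Set where
    short : ℕ → Vertex
    long  : Fin 3 → ℕ → Vertex

  Valid : Vertex → Set
  Valid (short u)  = u ≤ n
  Valid (long j p) = p ≤ suc m

  distance : Vertex → Vertex → ℕ
  distance (short t)  (short u)  = ∣ t - u ∣
  distance (short t)  (long j p) = (suc t ℕ.+ p) ⊓ (suc (n ∸ t) ℕ.+ (suc m ∸ p))
  distance (long j p) (short u)  = (suc p ℕ.+ u) ⊓ (suc (suc m ∸ p) ℕ.+ (n ∸ u))
  distance (long i p) (long j q) =
    if does (i ≟ j) then ∣ p - q ∣ else (suc (suc p) ℕ.+ q) ⊓ (suc (suc (suc m ∸ p)) ℕ.+ (suc m ∸ q))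

  distance-self : ∀ x → distance x x ≡ 0
  distance-self (short t)  = ℕP.∣n-n∣≡0 t
  distance-self (long j p) rewrite dec-true (j ≟ j) refl = ℕP.∣n-n∣≡0 p

  data Edge : Vertex → Vertex → Set where
    short-step : ∀ {t} → t < n → Edge (short t) (short (suc t))
    enter      : ∀ j → Edge (short 0) (long j 0)
    long-step  : ∀ j {p} → p < suc m → Edge (long j p) (long j (suc p))
    leave      : ∀ j → Edge (long j (suc m)) (short n)

  private
    via-a-shorter : ∀ {p} → p ≤ suc m → ∀ c → suc m ≤ c → p ⊓ (c ℕ.+ (suc m ∸ p)) ≡ p
    via-a-shorter {p} p≤ c le = ℕP.m≤n⇒m⊓n≡m (ℕP.≤-trans p≤ (ℕP.≤-trans le (ℕP.m≤m+n c _)))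
    via-b-shorter : ∀ {p} → p ≤ suc m → ∀ c → suc m ≤ c → (c ℕ.+ p) ⊓ ((m ∸ m) ℕ.+ (suc m ∸ p)) ≡ suc m ∸ p
    via-b-shorter {p} p≤ c le = trans (cong (λ z → (c ℕ.+ p) ⊓ (z ℕ.+ (suc m ∸ p))) (ℕP.n∸n≡0 m))
                          (ℕP.m≥n⇒m⊓n≡n (ℕP.≤-trans (ℕP.m∸n≤m (suc m) p) (ℕP.≤-trans le (ℕP.m≤m+n c p))))

  distance-near : ∀ {x y} → Edge x y → ∀ z → Valid z → Near (distance x z) (distance y z)
  distance-near (short-step {t} _) (short u)  _ = near-∣-∣ t u
  distance-near (short-step {t} _) (long j p) _ =
    near-⊓ (near-+ʳ p (near-suc (suc t))) (near-+ʳ (suc m ∸ p) (near-+ˡ 1 (near-∸ n t)))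
  distance-near (enter j) (short u) u≤n =
    near-⊓-suc (ℕP.≤-trans u≤n (s≤s (s≤s (ℕP.m≤m+n m (n ∸ u)))))
  distance-near (enter j) (long i p) p≤m+1 with j ≟ i
  ... | yes _ = subst (λ d → Near (suc d) p) (sym (via-a-shorter p≤m+1 n (ℕP.n≤1+n (suc m)))) (near-sym (near-suc p))
  ... | no  _ = subst₂ (λ d d′ → Near (suc d) (suc (suc d′)))
                  (sym (via-a-shorter p≤m+1 n (ℕP.n≤1+n (suc m)))) (sym (via-a-shorter p≤m+1 (suc m) ℕP.≤-refl))
                  (near-suc (suc p))
  distance-near (long-step j {p} _) (short u) _ =
    near-⊓ (near-+ʳ u (near-suc (suc p))) (near-+ʳ (n ∸ u) (near-+ˡ 1 (near-∸ (suc m) p)))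
  distance-near (long-step j {p} _) (long i q) _ with j ≟ i
  ... | yes _ = near-∣-∣ p q
  ... | no _  = near-⊓ (near-+ʳ q (near-suc (suc (suc p)))) (near-+ʳ (suc m ∸ q) (near-+ˡ 2 (near-∸ (suc m) p)))
  distance-near (leave j) (short u) u≤n = subst₂ Near
    (trans (ℕP.⊓-comm (suc (n ∸ u)) (n ℕ.+ u)) (cong (λ z → (n ℕ.+ u) ⊓ suc (z ℕ.+ (n ∸ u))) (sym (ℕP.n∸n≡0 m))))
    (sym (ℕP.m≤n⇒∣n-m∣≡n∸m u≤n))
    (near-sym (near-⊓-suc (ℕP.≤-trans (ℕP.m∸n≤m n u) (ℕP.m≤m+n n u))))
  distance-near (leave j) (long i p) p≤m+1 with j ≟ i
  ... | yes _ = subst₂ Near (sym (ℕP.m≤n⇒∣n-m∣≡n∸m p≤m+1))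
                  (cong suc (sym (via-b-shorter p≤m+1 n (ℕP.n≤1+n (suc m)))))
                  (near-suc (suc m ∸ p))
  ... | no  _ = subst₂ (λ d d′ → Near (suc (suc d)) (suc d′))
                  (sym (via-b-shorter p≤m+1 (suc m) ℕP.≤-refl)) (sym (via-b-shorter p≤m+1 n (ℕP.n≤1+n (suc m))))
                  (near-sym (near-suc (suc (suc m ∸ p))))

  armStart : Fin 3 → ℕ
  armStart zero             = k
  armStart (suc zero)       = k ℕ.+ n
  armStart (suc (suc zero)) = k ℕ.+ 2 ℕ.* n

  encode : Vertex → ℕ
  encode (short zero)    = 0
  encode (short (suc u)) = if does (u <? suc m) then suc (suc u) else 1
  encode (long j p)      = armStart j ℕ.+ p

  decodeLong : ℕ → Vertex
  decodeLong r =
    if does (r <? n) then long zero r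
    else if does (r ∸ n <? n) then long (suc zero) (r ∸ n)
    else long (suc (suc zero)) (r ∸ n ∸ n)

  decode : ℕ → Vertex
  decode zero          = short 0
  decode (suc zero)    = short n
  decode (suc (suc ℓ)) = if does (ℓ <? suc m) then short (suc ℓ) else decodeLong (ℓ ∸ suc m)

  encode-inner : ∀ {u} → u < suc m → encode (short (suc u)) ≡ suc (suc u)
  encode-inner {u} u<m+1 rewrite dec-true (u <? suc m) u<m+1 = refl

  encode-hub : encode (short n) ≡ 1
  encode-hub rewrite dec-false (suc m <? suc m) (ℕP.n≮n (suc m)) = refl

  decode-inner : ∀ {u} → u < suc m → decode (suc (suc u)) ≡ short (suc u)
  decode-inner {u} u<m+1 rewrite dec-true (u <? suc m) u<m+1 = refl

  offset : Fin 3 → ℕ → ℕ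
  offset zero             p = p
  offset (suc zero)       p = n ℕ.+ p
  offset (suc (suc zero)) p = n ℕ.+ (n ℕ.+ p)

  armStart-+ : ∀ j p → armStart j ℕ.+ p ≡ k ℕ.+ offset j p
  armStart-+ zero             p = refl
  armStart-+ (suc zero)       p = ℕP.+-assoc k n p
  armStart-+ (suc (suc zero)) p = trans (ℕP.+-assoc k (2 ℕ.* n) p)
    (cong (k ℕ.+_) (trans (cong (λ c → n ℕ.+ c ℕ.+ p) (ℕP.+-identityʳ n)) (ℕP.+-assoc n n p)))

  decode-offset : ∀ j {p} → p < n → decode (k ℕ.+ offset j p) ≡ long j p
  decode-offset j {p} p<n = trans (decode-k+ (offset j p)) (decodeLong-offset j)
    where
    decode-k+ : ∀ r → decode (k ℕ.+ r) ≡ decodeLong r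
    decode-k+ r rewrite dec-false (suc m ℕ.+ r <? suc m) (ℕP.≤⇒≯ (ℕP.m≤m+n (suc m) r)) | ℕP.m+n∸m≡n (suc m) r = refl
    beyond : ∀ q → does (n ℕ.+ q <? n) ≡ false
    beyond q = dec-false (n ℕ.+ q <? n) (ℕP.≤⇒≯ (ℕP.m≤m+n n q))
    decodeLong-offset : ∀ j → decodeLong (offset j p) ≡ long j p
    decodeLong-offset zero rewrite dec-true (p <? n) p<n = refl
    decodeLong-offset (suc zero)
      rewrite beyond p | ℕP.m+n∸m≡n n p | dec-true (p <? n) p<n = refl
    decodeLong-offset (suc (suc zero))
      rewrite beyond (n ℕ.+ p) | ℕP.m+n∸m≡n n (n ℕ.+ p) | beyond p | ℕP.m+n∸m≡n n p = refl

  decode-long : ∀ j {p} → p < n → decode (armStart j ℕ.+ p) ≡ long j p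
  decode-long j {p} p<n = trans (cong decode (armStart-+ j p)) (decode-offset j p<n)

  decode-encode : ∀ {x} → Valid x → decode (encode x) ≡ x
  decode-encode {short zero}    _ = refl
  decode-encode {short (suc u)} (s≤s u≤m+1) with ℕP.m≤n⇒m<n∨m≡n u≤m+1
  ... | inj₁ u<m+1 = trans (cong decode (encode-inner u<m+1)) (decode-inner u<m+1)
  ... | inj₂ refl  = cong decode encode-hub
  decode-encode {long j p} p≤m+1 = decode-long j (s≤s p≤m+1)

  basket-edge⁻ : ∀ {e} → e ∈ basketEdges k → ArmEdge 2 m e ⊎ Σ (Fin 3) λ j → ArmEdge (armStart j) (suc m) e
  basket-edge⁻ e∈ with ∈-++⁻ (pathEdges (arm 2 (suc m))) e∈
  ... | inj₁ e∈₀ = inj₁ (arm-edge⁻ 2 m e∈₀)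
  ... | inj₂ e∈′ with ∈-++⁻ (pathEdges (arm (armStart zero) n)) e∈′
  ...   | inj₁ e∈₁ = inj₂ (zero , arm-edge⁻ (armStart zero) (suc m) e∈₁)
  ...   | inj₂ e∈″ with ∈-++⁻ (pathEdges (arm (armStart (suc zero)) n)) e∈″
  ...     | inj₁ e∈₂ = inj₂ (suc zero , arm-edge⁻ (armStart (suc zero)) (suc m) e∈₂)
  ...     | inj₂ e∈₃ = inj₂ (suc (suc zero) , arm-edge⁻ (armStart (suc (suc zero))) (suc m) e∈₃)

  short-edge⁺ : ∀ {e} → ArmEdge 2 m e → e ∈ basketEdges k
  short-edge⁺ e = ∈-++⁺ˡ (arm-edge⁺ 2 m e)

  long-edge⁺ : ∀ j {e} → ArmEdge (armStart j) (suc m) e → e ∈ basketEdges k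
  long-edge⁺ zero             e = ∈-++⁺ʳ (pathEdges (arm 2 (suc m))) (∈-++⁺ˡ (arm-edge⁺ _ (suc m) e))
  long-edge⁺ (suc zero)       e = ∈-++⁺ʳ (pathEdges (arm 2 (suc m))) (∈-++⁺ʳ (pathEdges (arm (armStart zero) n))
                                    (∈-++⁺ˡ (arm-edge⁺ _ (suc m) e)))
  long-edge⁺ (suc (suc zero)) e = ∈-++⁺ʳ (pathEdges (arm 2 (suc m))) (∈-++⁺ʳ (pathEdges (arm (armStart zero) n))
                                    (∈-++⁺ʳ (pathEdges (arm (armStart (suc zero)) n)) (arm-edge⁺ _ (suc m) e)))

  edge⁻ : ∀ {ℓ ℓ′} → (ℓ , ℓ′) ∈ basketEdges k → Edge (decode ℓ) (decode ℓ′)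
  edge⁻ e∈ with basket-edge⁻ e∈
  ... | inj₁ first = subst (Edge (short 0)) (sym (decode-inner (s≤s z≤n))) (short-step (s≤s z≤n))
  ... | inj₁ (inner {i} i<m) =
    subst₂ Edge (sym (decode-inner (ℕP.m<n⇒m<1+n i<m))) (sym (decode-inner (s≤s i<m))) (short-step (s≤s (ℕP.m<n⇒m<1+n i<m)))
  ... | inj₁ last = subst (λ x → Edge x (short n)) (sym (decode-inner ℕP.≤-refl)) (short-step ℕP.≤-refl)
  ... | inj₂ (j , first) = subst (Edge (short 0)) (sym (decode-long j (s≤s z≤n))) (enter j)
  ... | inj₂ (j , inner {p} p<m+1) =
    subst₂ Edge (sym (decode-long j (ℕP.m<n⇒m<1+n p<m+1))) (sym (decode-long j (s≤s p<m+1))) (long-step j p<m+1)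
  ... | inj₂ (j , last) = subst (λ x → Edge x (short n)) (sym (decode-long j ℕP.≤-refl)) (leave j)

  edge⁺ : ∀ {x y} → Edge x y → (encode x , encode y) ∈ basketEdges k
  edge⁺ (short-step {zero} _) = subst (λ ℓ → (0 , ℓ) ∈ basketEdges k) (sym (encode-inner (s≤s z≤n))) (short-edge⁺ first)
  edge⁺ (short-step {suc i} (s≤s i<n)) with ℕP.m≤n⇒m<n∨m≡n (ℕP.≤-pred i<n)
  ... | inj₁ i<m = subst₂ (λ ℓ ℓ′ → (ℓ , ℓ′) ∈ basketEdges k)
                     (sym (encode-inner (ℕP.m<n⇒m<1+n i<m))) (sym (encode-inner (s≤s i<m))) (short-edge⁺ (inner i<m))
  ... | inj₂ refl = subst₂ (λ ℓ ℓ′ → (ℓ , ℓ′) ∈ basketEdges k)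
                     (sym (encode-inner ℕP.≤-refl)) (sym encode-hub) (short-edge⁺ last)
  edge⁺ (enter j)           = long-edge⁺ j first
  edge⁺ (long-step j p<m+1) = long-edge⁺ j (inner p<m+1)
  edge⁺ (leave j)           = subst (λ ℓ → (armStart j ℕ.+ suc m , ℓ) ∈ basketEdges k) (sym encode-hub) (long-edge⁺ j last)

  edge-walk : ∀ {x y} → Edge x y → Walk k (encode x) (encode y) 1
  edge-walk e = step (inj₁ (edge⁺ e)) here

  walk-along : (h : ℕ → Vertex) (B : ℕ) → (∀ {i} → i < B → Edge (h i) (h (suc i))) →
               ∀ i L → i ℕ.+ L ≤ B → Walk k (encode (h i)) (encode (h (i ℕ.+ L))) L
  walk-along h B e i zero    _   = subst (λ j → Walk k (encode (h i)) (encode (h j)) 0) (sym (ℕP.+-identityʳ i)) here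
  walk-along h B e i (suc L) i+L<B = step (inj₁ (edge⁺ (e (ℕP.<-≤-trans (s≤s (ℕP.m≤m+n i L)) i+1+L≤B))))
    (subst (λ j → Walk k (encode (h (suc i))) (encode (h j)) L) (sym (ℕP.+-suc i L)) (walk-along h B e (suc i) L i+1+L≤B))
    where
    i+1+L≤B : suc i ℕ.+ L ≤ B
    i+1+L≤B = subst (_≤ B) (ℕP.+-suc i L) i+L<B

  walk-between : (h : ℕ → Vertex) (B : ℕ) → (∀ {i} → i < B → Edge (h i) (h (suc i))) →
                 ∀ {s t} → s ≤ B → t ≤ B → Walk k (encode (h s)) (encode (h t)) ∣ s - t ∣
  walk-between h B e {s} {t} s≤B t≤B with ℕP.≤-total s t
  ... | inj₁ s≤t = subst₂ (λ j L → Walk k (encode (h s)) (encode (h j)) L)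
                     (ℕP.m+[n∸m]≡n s≤t) (sym (ℕP.m≤n⇒∣m-n∣≡n∸m s≤t))
                     (walk-along h B e s (t ∸ s) (subst (_≤ B) (sym (ℕP.m+[n∸m]≡n s≤t)) t≤B))
  ... | inj₂ t≤s = subst₂ (λ j L → Walk k (encode (h j)) (encode (h t)) L)
                     (ℕP.m+[n∸m]≡n t≤s) (sym (ℕP.m≤n⇒∣n-m∣≡n∸m t≤s))
                     (reverse (walk-along h B e t (s ∸ t) (subst (_≤ B) (sym (ℕP.m+[n∸m]≡n t≤s)) s≤B)))

  walk-short : ∀ {t u} → t ≤ n → u ≤ n → Walk k (encode (short t)) (encode (short u)) ∣ t - u ∣
  walk-short = walk-between short n short-step

  walk-long : ∀ j {p q} → p ≤ suc m → q ≤ suc m → Walk k (encode (long j p)) (encode (long j q)) ∣ p - q ∣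
  walk-long j = walk-between (long j) (suc m) (long-step j)

  walk-short-long : ∀ {t j p} → t ≤ n → p ≤ suc m →
                    Walk k (encode (short t)) (encode (long j p)) (distance (short t) (long j p))
  walk-short-long {t} {j} {p} t≤n p≤m+1 = shorter
    (subst (Walk k _ _) (trans (cong (ℕ._+ suc p) (ℕP.∣-∣-identityʳ t)) (ℕP.+-suc t p))
      (walk-short t≤n z≤n ++ʷ (edge-walk (enter j) ++ʷ walk-long j z≤n p≤m+1)))
    (subst (Walk k _ _) (trans (cong (ℕ._+ suc (suc m ∸ p)) (ℕP.m≤n⇒∣m-n∣≡n∸m t≤n)) (ℕP.+-suc (n ∸ t) _))
      (walk-short t≤n ℕP.≤-refl ++ʷ (reverse (edge-walk (leave j)) ++ʷ
        subst (Walk k _ _) (ℕP.m≤n⇒∣n-m∣≡n∸m p≤m+1) (walk-long j ℕP.≤-refl p≤m+1))))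

  walk-long-long : ∀ {i j p q} → i ≢ j → p ≤ suc m → q ≤ suc m →
    Walk k (encode (long i p)) (encode (long j q)) ((suc (suc p) ℕ.+ q) ⊓ (suc (suc (suc m ∸ p)) ℕ.+ (suc m ∸ q)))
  walk-long-long {i} {j} {p} {q} _ p≤m+1 q≤m+1 = shorter
    (subst (Walk k _ _) (trans (cong (ℕ._+ suc (suc q)) (ℕP.∣-∣-identityʳ p))
                               (trans (ℕP.+-suc p (suc q)) (cong suc (ℕP.+-suc p q))))
      (walk-long i p≤m+1 z≤n ++ʷ (reverse (edge-walk (enter i)) ++ʷ (edge-walk (enter j) ++ʷ walk-long j z≤n q≤m+1))))
    (subst (Walk k _ _) (trans (cong (ℕ._+ suc (suc (suc m ∸ q))) (ℕP.m≤n⇒∣m-n∣≡n∸m p≤m+1))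
                               (trans (ℕP.+-suc (suc m ∸ p) _) (cong suc (ℕP.+-suc (suc m ∸ p) _))))
      (walk-long i p≤m+1 ℕP.≤-refl ++ʷ (edge-walk (leave i) ++ʷ (reverse (edge-walk (leave j)) ++ʷ
        subst (Walk k _ _) (ℕP.m≤n⇒∣n-m∣≡n∸m q≤m+1) (walk-long j ℕP.≤-refl q≤m+1)))))

  distance-walk : ∀ {x y} → Valid x → Valid y → Walk k (encode x) (encode y) (distance x y)
  distance-walk {short t}  {short u}  t≤n u≤n = walk-short t≤n u≤n
  distance-walk {short t}  {long j p} t≤n p≤m+1 = walk-short-long {j = j} t≤n p≤m+1
  distance-walk {long j p} {short u}  p≤m+1 u≤n = subst (Walk k _ _)
    (cong₂ _⊓_ (cong suc (ℕP.+-comm u p)) (cong suc (ℕP.+-comm (n ∸ u) (suc m ∸ p))))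
    (reverse (walk-short-long {j = j} u≤n p≤m+1))
  distance-walk {long i p} {long j q} p≤m+1 q≤m+1 with i ≟ j
  ... | yes refl = walk-long i p≤m+1 q≤m+1
  ... | no  i≢j  = walk-long-long i≢j p≤m+1 q≤m+1

  distance-≤-length : ∀ {a b L} → Walk k a b L → Valid (decode b) → distance (decode a) (decode b) ≤ L
  distance-≤-length {a} here _ = ℕP.≤-reflexive (distance-self (decode a))
  distance-≤-length (step (inj₁ e) w) valid =
    ℕP.≤-trans (proj₁ (distance-near (edge⁻ e) _ valid)) (s≤s (distance-≤-length w valid))
  distance-≤-length (step (inj₂ e) w) valid =
    ℕP.≤-trans (proj₂ (distance-near (edge⁻ e) _ valid)) (s≤s (distance-≤-length w valid))

  basketSize≡ : basketSize k ≡ k ℕ.+ (n ℕ.+ (n ℕ.+ n))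
  basketSize≡ = count m
    where
    count : ∀ m → m ℕ.+ (suc (suc (suc m)) ℕ.+ (suc (suc (suc m)) ℕ.+ (suc (suc (suc m)) ℕ.+ 0)))
                  ≡ suc (suc (suc m)) ℕ.+ (suc (suc m) ℕ.+ (suc (suc m) ℕ.+ suc (suc m)))
    count = ℕ-solve-∀

  encode-onto : ∀ ℓ → ℓ < basketSize k → Σ Vertex λ x → Valid x × encode x ≡ ℓ
  encode-onto ℓ ℓ<N with split-< k (subst (ℓ <_) basketSize≡ ℓ<N)
  encode-onto zero                _ | inj₁ _ = short 0 , z≤n , refl
  encode-onto (suc zero)          _ | inj₁ _ = short n , ℕP.≤-refl , encode-hub
  encode-onto (suc (suc i))       _ | inj₁ (s≤s (s≤s i<m+1)) = short (suc i) , s≤s (ℕP.<⇒≤ i<m+1) , encode-inner i<m+1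
  ... | inj₂ (r , r< , refl) with split-< n r<
  ...   | inj₁ r<n = long zero r , ℕP.≤-pred r<n , refl
  ...   | inj₂ (r′ , r′< , refl) with split-< n r′<
  ...     | inj₁ r′<n = long (suc zero) r′ , ℕP.≤-pred r′<n , armStart-+ (suc zero) r′
  ...     | inj₂ (r″ , r″<n , refl) = long (suc (suc zero)) r″ , ℕP.≤-pred r″<n , armStart-+ (suc (suc zero)) r″

  decode-valid : ∀ {ℓ} → ℓ < basketSize k → Valid (decode ℓ)
  decode-valid {ℓ} ℓ<N with encode-onto ℓ ℓ<N
  ... | x , valid , refl = subst Valid (sym (decode-encode valid)) valid

  distance-matrix : ∀ {ℓ ℓ′ d} → ℓ < basketSize k → ℓ′ < basketSize k → IsDist k ℓ ℓ′ d →
                    d ≡ distance (decode ℓ) (decode ℓ′)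
  distance-matrix {ℓ} {ℓ′} ℓ<N ℓ′<N (w , shortest) with encode-onto ℓ ℓ<N | encode-onto ℓ′ ℓ′<N
  ... | x , valid-x , refl | y , valid-y , refl = ℕP.≤-antisym
    (subst₂ (λ x′ y′ → _ ≤ distance x′ y′) (sym (decode-encode valid-x)) (sym (decode-encode valid-y))
            (shortest _ (distance-walk valid-x valid-y)))
    (distance-≤-length w (decode-valid ℓ′<N))

  open import Data.Integer using (_+_; _*_; _-_)

  weight : Vertex → ℤ
  weight (short u)  = ν u + ν (n ∸ u)
  weight (long j p) = ν p + ν (suc m ∸ p)

  armSum : (Vertex → ℤ) → Fin 3 → ℤ
  armSum G j = Σ⟨ n ⟩ λ p _ → G (long j p)

  vertexSum : (Vertex → ℤ) → ℤ
  vertexSum G = Σ⟨ suc n ⟩ (λ u _ → G (short u)) + (armSum G zero + (armSum G (suc zero) + armSum G (suc (suc zero))))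

  label-sum : ∀ G → Σ⟨ basketSize k ⟩ (λ ℓ _ → G (decode ℓ)) ≡ vertexSum G
  label-sum G = begin
    Σ⟨ basketSize k ⟩ (λ ℓ _ → g ℓ)
      ≡⟨ cong (λ N → Σ⟨ N ⟩ λ ℓ _ → g ℓ) basketSize≡ ⟩
    Σ⟨ k ℕ.+ (n ℕ.+ (n ℕ.+ n)) ⟩ (λ ℓ _ → g ℓ)
      ≡⟨ Σ-blocks k (n ℕ.+ (n ℕ.+ n)) g ⟩
    Σ⟨ k ⟩ (λ ℓ _ → g ℓ) + Σ⟨ n ℕ.+ (n ℕ.+ n) ⟩ (λ r _ → g (k ℕ.+ r))
      ≡⟨ cong₂ _+_ short-block (trans (Σ-blocks n (n ℕ.+ n) (λ r → g (k ℕ.+ r)))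
                    (cong (_+_ (Σ⟨ n ⟩ λ p _ → g (k ℕ.+ p))) (Σ-blocks n n (λ r → g (k ℕ.+ (n ℕ.+ r)))))) ⟩
    G (short 0) + (G (short n) + Σ⟨ suc m ⟩ (λ i _ → G (short (suc i))))
      + (Σ⟨ n ⟩ (λ p _ → g (k ℕ.+ p)) + (Σ⟨ n ⟩ (λ p _ → g (k ℕ.+ (n ℕ.+ p))) + Σ⟨ n ⟩ (λ p _ → g (k ℕ.+ (n ℕ.+ (n ℕ.+ p))))))
      ≡⟨ cong₂ _+_ (cong (_+_ (G (short 0))) (trans (ℤP.+-comm (G (short n)) _) (sym (Σ-snoc (suc m) λ i _ → G (short (suc i))))))
                   (cong₂ _+_ (long-block zero) (cong₂ _+_ (long-block (suc zero)) (long-block (suc (suc zero))))) ⟩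
    vertexSum G ∎
    where
    open ≡-Reasoning
    g : ℕ → ℤ
    g ℓ = G (decode ℓ)
    short-block : Σ⟨ k ⟩ (λ ℓ _ → g ℓ) ≡ G (short 0) + (G (short n) + Σ⟨ suc m ⟩ (λ i _ → G (short (suc i))))
    short-block = cong (λ s → G (short 0) + (G (short n) + s)) (Σ-cong (suc m) λ i _ eq →
      cong G (decode-inner (subst (suc i ℕ.≤_) eq (s≤s (ℕP.m≤m+n i _)))))
    long-block : ∀ j → Σ⟨ n ⟩ (λ p _ → g (k ℕ.+ offset j p)) ≡ armSum G j
    long-block j = Σ-cong n λ p _ eq → cong G (decode-offset j (subst (suc p ℕ.≤_) eq (s≤s (ℕP.m≤m+n p _))))

  total-weight : vertexSum weight ≡ + 2
  total-weight = ℤP.*-cancelˡ-≡ (+ 4) _ _ (begin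
    + 4 * vertexSum weight
      ≡⟨ cong (+ 4 *_) (cong₂ _+_ (Σ-complement n F) (cong₂ _+_ long-part (cong₂ _+_ long-part long-part))) ⟩
    + 4 * (Σ⟨ suc n ⟩ F + (Σ⟨ n ⟩ F + (Σ⟨ n ⟩ F + Σ⟨ n ⟩ F)))
      ≡⟨ regroup (Σ⟨ suc n ⟩ F) (Σ⟨ n ⟩ F) ⟩
    + 4 * Σ⟨ suc n ⟩ F + + 3 * (+ 4 * Σ⟨ n ⟩ F)
      ≡⟨ cong₂ (λ a b → a + + 3 * b) (Σ-symmetric-geometric (suc n)) (Σ-symmetric-geometric n) ⟩
    + 2 * (+ 1 - -[1+ 2 ] * ν n) + + 3 * (+ 2 * (+ 1 - ν n))
      ≡⟨ cancel (ν n) ⟩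
    + 4 * + 2 ∎)
    where
    open ≡-Reasoning
    F : ℕ → ℕ → ℤ
    F u v = ν u + ν v
    long-part : Σ⟨ n ⟩ (λ p _ → ν p + ν (suc m ∸ p)) ≡ Σ⟨ n ⟩ F
    long-part = Σ-complement (suc m) F
    regroup : ∀ a b → + 4 * (a + (b + (b + b))) ≡ + 4 * a + + 3 * (+ 4 * b)
    regroup = solve-∀
    cancel : ∀ x → + 2 * (+ 1 - -[1+ 2 ] * x) + + 3 * (+ 2 * (+ 1 - x)) ≡ + 4 * + 2
    cancel = solve-∀

  basketNumerator : ℤ
  basketNumerator = ν k + + (4 ℕ.* k) - + 1

  basketNumerator-split : ∀ a b → suc (a ℕ.+ b) ≡ k →
                          basketNumerator ≡ -[1+ 2 ] * (ν a * ν b) + + 4 * (+ 1 + (+ a + + b)) - + 1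
  basketNumerator-split a b eq = trans (cong (λ c → ν c + + (4 ℕ.* c) - + 1) (sym eq))
    (cong₂ (λ x y → -[1+ 2 ] * x + y - + 1) (ν-+ a b)
           (trans (ℤP.pos-* 4 (suc (a ℕ.+ b))) (cong (λ z → + 4 * (+ 1 + z)) (ℤP.pos-+ a b))))

  row-short : ∀ {t} → t ≤ n → + 4 * vertexSum (λ w → + distance (short t) w * weight w) ≡ basketNumerator
  row-short {t} t≤n = ℤP.*-cancelˡ-≡ (+ 16) _ _ (begin
    + 16 * (+ 4 * vertexSum (λ w → + distance (short t) w * weight w))
      ≡⟨ cong (λ s → + 16 * (+ 4 * s)) (cong₂ _+_ short-part (cong₂ _+_ long-part (cong₂ _+_ long-part long-part))) ⟩
    + 16 * (+ 4 * (Σ⟨ suc (t ℕ.+ t′) ⟩ F + (Σ⟨ t′ ℕ.+ t ⟩ G + (Σ⟨ t′ ℕ.+ t ⟩ G + Σ⟨ t′ ℕ.+ t ⟩ G))))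
      ≡⟨ regroup (Σ⟨ suc (t ℕ.+ t′) ⟩ F) (Σ⟨ t′ ℕ.+ t ⟩ G) ⟩
    + 4 * (+ 16 * Σ⟨ suc (t ℕ.+ t′) ⟩ F + + 3 * (+ 16 * Σ⟨ t′ ℕ.+ t ⟩ G))
      ≡⟨ cong₂ (λ a b → + 4 * (a + + 3 * b)) (Σ-∣-∣-closed-form t t′)
           (Σ-⊓-closed-form (suc t) (suc t′) t′ t (≡⇒near (cong suc (ℕP.+-comm t t′)))) ⟩
    _
      ≡⟨ identity (+ t) (+ t′) (ν t) (ν t′) ⟩
    + 16 * (-[1+ 2 ] * (ν t * ν t′) + + 4 * (+ 1 + (+ t + + t′)) - + 1)
      ≡⟨ cong (+ 16 *_) (sym (basketNumerator-split t t′ (cong suc split))) ⟩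
    + 16 * basketNumerator ∎)
    where
    open ≡-Reasoning
    t′ = n ∸ t
    split : t ℕ.+ t′ ≡ n
    split = ℕP.m+[n∸m]≡n t≤n
    F G : ℕ → ℕ → ℤ
    F u v = + ∣ t - u ∣ * (ν u + ν v)
    G p q = + ((suc t ℕ.+ p) ⊓ (suc t′ ℕ.+ q)) * (ν p + ν q)
    short-part : Σ⟨ suc n ⟩ (λ u _ → + ∣ t - u ∣ * weight (short u)) ≡ Σ⟨ suc (t ℕ.+ t′) ⟩ F
    short-part = trans (Σ-complement n F) (cong (λ L → Σ⟨ suc L ⟩ F) (sym split))
    long-part : Σ⟨ n ⟩ (λ p _ → + distance (short t) (long zero p) * weight (long zero p)) ≡ Σ⟨ t′ ℕ.+ t ⟩ G
    long-part = trans (Σ-complement (suc m) G) (cong (λ L → Σ⟨ L ⟩ G) (trans (sym split) (ℕP.+-comm t t′)))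
    regroup : ∀ a b → + 16 * (+ 4 * (a + (b + (b + b)))) ≡ + 4 * (+ 16 * a + + 3 * (+ 16 * b))
    regroup = solve-∀
    identity : ∀ t t′ x y →
      + 4 * (+ 6 * ((+ 1 - x) * (+ 1 - y)) + + 4 * (t + t′) * (+ 1 + + 3 * (x * y))
        + + 3 * (+ 4 * (+ 1 + t) * ((+ 1 - y) * (+ 1 + x)) + + 4 * (+ 1 + t′) * ((+ 1 + y) * (+ 1 - x))
                 + + 2 * (y + x + y * x - + 3) + + 4 * (t - t′) * (y - x)))
        ≡ + 16 * (-[1+ 2 ] * (x * y) + + 4 * (+ 1 + (t + t′)) - + 1)
    identity = solve-∀

  row-long : ∀ j {τ} → τ ≤ suc m → + 4 * vertexSum (λ w → + distance (long j τ) w * weight w) ≡ basketNumerator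
  row-long j {τ} τ≤m+1 = ℤP.*-cancelˡ-≡ (+ 16) _ _ (begin
    + 16 * (+ 4 * vertexSum (λ w → + distance (long j τ) w * weight w))
      ≡⟨ cong (λ s → + 16 * (+ 4 * s)) (by-arms j) ⟩
    + 16 * (+ 4 * (Σ⟨ suc τ′ ℕ.+ suc τ ⟩ F + Σ⟨ suc (τ ℕ.+ τ′) ⟩ H + + 2 * Σ⟨ suc τ′ ℕ.+ τ ⟩ G))
      ≡⟨ regroup (Σ⟨ suc τ′ ℕ.+ suc τ ⟩ F) (Σ⟨ suc (τ ℕ.+ τ′) ⟩ H) (Σ⟨ suc τ′ ℕ.+ τ ⟩ G) ⟩
    + 4 * (+ 16 * Σ⟨ suc τ′ ℕ.+ suc τ ⟩ F + + 16 * Σ⟨ suc (τ ℕ.+ τ′) ⟩ H + + 2 * (+ 16 * Σ⟨ suc τ′ ℕ.+ τ ⟩ G))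
      ≡⟨ cong₂ (λ ab c → + 4 * (ab + + 2 * c)) (cong₂ _+_
           (Σ-⊓-closed-form (suc τ) (suc τ′) (suc τ′) (suc τ) (≡⇒near (cong suc cross)))
           (Σ-∣-∣-closed-form τ τ′))
           (Σ-⊓-closed-form (suc (suc τ)) (suc (suc τ′)) (suc τ′) τ
             (subst (λ a → Near (suc (suc a)) (suc (suc (τ′ ℕ.+ τ)))) (sym τ+1+τ′≡) (near-sym (near-suc _)))) ⟩
    _
      ≡⟨ identity (+ τ) (+ τ′) (ν τ) (ν τ′) ⟩
    + 16 * (-[1+ 2 ] * (-[1+ 2 ] * ν τ * ν τ′) + + 4 * (+ 1 + (+ suc τ + + τ′)) - + 1)
      ≡⟨ cong (+ 16 *_) (sym (basketNumerator-split (suc τ) τ′ (cong (ℕ.suc ∘ ℕ.suc) split))) ⟩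
    + 16 * basketNumerator ∎)
    where
    open ≡-Reasoning
    τ′ = suc m ∸ τ
    split : τ ℕ.+ τ′ ≡ suc m
    split = ℕP.m+[n∸m]≡n τ≤m+1
    F G H : ℕ → ℕ → ℤ
    F u v = + ((suc τ ℕ.+ u) ⊓ (suc τ′ ℕ.+ v)) * (ν u + ν v)
    G p q = + ((suc (suc τ) ℕ.+ p) ⊓ (suc (suc τ′) ℕ.+ q)) * (ν p + ν q)
    H p q = + ∣ τ - p ∣ * (ν p + ν q)
    Across Own Other : ℤ
    Across = Σ⟨ suc τ′ ℕ.+ suc τ ⟩ F
    Own    = Σ⟨ suc (τ ℕ.+ τ′) ⟩ H
    Other  = Σ⟨ suc τ′ ℕ.+ τ ⟩ G
    τ+1+τ′≡ : τ ℕ.+ suc τ′ ≡ suc (τ′ ℕ.+ τ)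
    τ+1+τ′≡ = trans (ℕP.+-suc τ τ′) (cong suc (ℕP.+-comm τ τ′))
    cross : τ ℕ.+ suc τ′ ≡ τ′ ℕ.+ suc τ
    cross = trans τ+1+τ′≡ (sym (ℕP.+-suc τ′ τ))
    short-part : Σ⟨ suc n ⟩ (λ u _ → + distance (long j τ) (short u) * weight (short u)) ≡ Σ⟨ suc τ′ ℕ.+ suc τ ⟩ F
    short-part = trans (Σ-complement n F) (cong (λ L → Σ⟨ L ⟩ F)
      (trans (cong (ℕ.suc ∘ ℕ.suc) (trans (sym split) (ℕP.+-comm τ τ′))) (cong suc (sym (ℕP.+-suc τ′ τ)))))
    own-part : ∀ i → Σ⟨ n ⟩ (λ p _ → + ∣ τ - p ∣ * weight (long i p)) ≡ Σ⟨ suc (τ ℕ.+ τ′) ⟩ H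
    own-part _ = trans (Σ-complement (suc m) H) (cong (λ L → Σ⟨ suc L ⟩ H) (sym split))
    other-part : ∀ i → Σ⟨ n ⟩ (λ p _ → + ((suc (suc τ) ℕ.+ p) ⊓ (suc (suc τ′) ℕ.+ (suc m ∸ p))) * weight (long i p))
                       ≡ Σ⟨ suc τ′ ℕ.+ τ ⟩ G
    other-part _ = trans (Σ-complement (suc m) G) (cong (λ L → Σ⟨ suc L ⟩ G) (trans (sym split) (ℕP.+-comm τ τ′)))
    by-arms : ∀ j → vertexSum (λ w → + distance (long j τ) w * weight w)
                  ≡ Σ⟨ suc τ′ ℕ.+ suc τ ⟩ F + Σ⟨ suc (τ ℕ.+ τ′) ⟩ H + + 2 * Σ⟨ suc τ′ ℕ.+ τ ⟩ G
    by-arms zero = trans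
      (cong₂ _+_ short-part (cong₂ _+_ (own-part zero) (cong₂ _+_ (other-part (suc zero)) (other-part (suc (suc zero))))))
      (arrange Across Own Other)
      where arrange : ∀ a b c → a + (b + (c + c)) ≡ a + b + + 2 * c
            arrange = solve-∀
    by-arms (suc zero) = trans
      (cong₂ _+_ short-part (cong₂ _+_ (other-part zero) (cong₂ _+_ (own-part (suc zero)) (other-part (suc (suc zero))))))
      (arrange Across Own Other)
      where arrange : ∀ a b c → a + (c + (b + c)) ≡ a + b + + 2 * c
            arrange = solve-∀
    by-arms (suc (suc zero)) = trans
      (cong₂ _+_ short-part (cong₂ _+_ (other-part zero) (cong₂ _+_ (other-part (suc zero)) (own-part (suc (suc zero))))))
      (arrange Across Own Other)
      where arrange : ∀ a b c → a + (c + (c + b)) ≡ a + b + + 2 * c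
            arrange = solve-∀
    regroup : ∀ a b c → + 16 * (+ 4 * (a + b + + 2 * c)) ≡ + 4 * (+ 16 * a + + 16 * b + + 2 * (+ 16 * c))
    regroup = solve-∀
    identity : ∀ τ τ′ x y →
      + 4 * (+ 4 * (+ 1 + τ) * ((+ 1 - -[1+ 2 ] * y) * (+ 1 + -[1+ 2 ] * x))
                + + 4 * (+ 1 + τ′) * ((+ 1 + -[1+ 2 ] * y) * (+ 1 - -[1+ 2 ] * x))
                + + 2 * (-[1+ 2 ] * y + -[1+ 2 ] * x + -[1+ 2 ] * y * (-[1+ 2 ] * x) - + 3)
                + + 4 * ((+ 1 + τ) - (+ 1 + τ′)) * (-[1+ 2 ] * y - -[1+ 2 ] * x)
        + (+ 6 * ((+ 1 - x) * (+ 1 - y)) + + 4 * (τ + τ′) * (+ 1 + + 3 * (x * y)))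
        + + 2 * (+ 4 * (+ 2 + τ) * ((+ 1 - -[1+ 2 ] * y) * (+ 1 + x)) + + 4 * (+ 2 + τ′) * ((+ 1 + -[1+ 2 ] * y) * (+ 1 - x))
                 + + 2 * (-[1+ 2 ] * y + x + -[1+ 2 ] * y * x - + 3) + + 4 * (τ - (+ 1 + τ′)) * (-[1+ 2 ] * y - x)))
        ≡ + 16 * (-[1+ 2 ] * (-[1+ 2 ] * x * y) + + 4 * (+ 1 + ((+ 1 + τ) + τ′)) - + 1)
    identity = solve-∀

  vertex-row : ∀ {x} → Valid x → + 4 * vertexSum (λ w → + distance x w * weight w) ≡ basketNumerator
  vertex-row {short t}  t≤n   = row-short t≤n
  vertex-row {long j τ} τ≤m+1 = row-long j τ≤m+1

fromℚᵘ-+ : ∀ p q → fromℚᵘ p ℚ.+ fromℚᵘ q ≡ fromℚᵘ (p ℚᵘ.+ q)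
fromℚᵘ-+ p q = trans (sym (fromℚᵘ-toℚᵘ _))
  (fromℚᵘ-cong (ℚᵘP.≃-trans (toℚᵘ-homo-+ (fromℚᵘ p) (fromℚᵘ q)) (ℚᵘP.+-cong (toℚᵘ-fromℚᵘ p) (toℚᵘ-fromℚᵘ q))))

fromℚᵘ-* : ∀ p q → fromℚᵘ p ℚ.* fromℚᵘ q ≡ fromℚᵘ (p ℚᵘ.* q)
fromℚᵘ-* p q = trans (sym (fromℚᵘ-toℚᵘ _))
  (fromℚᵘ-cong (ℚᵘP.≃-trans (toℚᵘ-homo-* (fromℚᵘ p) (fromℚᵘ q)) (ℚᵘP.*-cong (toℚᵘ-fromℚᵘ p) (toℚᵘ-fromℚᵘ q))))

halves-+ : ∀ a b → a / 2 ℚ.+ b / 2 ≡ (a ℤ.+ b) / 2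
halves-+ a b = trans (fromℚᵘ-+ (mkℚᵘ a 1) (mkℚᵘ b 1))
  (fromℚᵘ-cong {mkℚᵘ a 1 ℚᵘ.+ mkℚᵘ b 1} {mkℚᵘ (a ℤ.+ b) 1} (*≡* (scale a b)))
  where
  scale : ∀ a b → (a ℤ.* + 2 ℤ.+ b ℤ.* + 2) ℤ.* + 2 ≡ (a ℤ.+ b) ℤ.* + 4
  scale = solve-∀

integer-*-half : ∀ d w → (+ d / 1) ℚ.* (w / 2) ≡ (+ d ℤ.* w) / 2
integer-*-half d w = trans (fromℚᵘ-* (mkℚᵘ (+ d) 0) (mkℚᵘ w 1))
  (fromℚᵘ-cong {mkℚᵘ (+ d) 0 ℚᵘ.* mkℚᵘ w 1} {mkℚᵘ (+ d ℤ.* w) 1} (*≡* refl))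

half≡eighth : ∀ {a b} → + 4 ℤ.* a ≡ b → a / 2 ≡ b / 8
half≡eighth {a} refl = fromℚᵘ-cong {mkℚᵘ a 1} {mkℚᵘ (+ 4 ℤ.* a) 7} (*≡* (scale a))
  where
  scale : ∀ a → a ℤ.* + 8 ≡ (+ 4 ℤ.* a) ℤ.* + 2
  scale = solve-∀

sumFin-cong : ∀ {N} {f g : Fin N → ℚ} → (∀ j → f j ≡ g j) → sumFin f ≡ sumFin g
sumFin-cong {zero}  f≡g = refl
sumFin-cong {suc N} f≡g = cong₂ ℚ._+_ (f≡g zero) (sumFin-cong (f≡g ∘ suc))

sumFin-halves : ∀ {N} (f : ℕ → ℤ) → sumFin {N} (λ j → f (toℕ j) / 2) ≡ Σ⟨ N ⟩ (λ ℓ _ → f ℓ) / 2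
sumFin-halves {zero}  f = refl
sumFin-halves {suc N} f = trans (cong (f 0 / 2 ℚ.+_) (sumFin-halves {N} (f ∘ suc))) (halves-+ (f 0) _)

open import Data.Rational using (_*_)

lemma2p2 : (k : ℕ) → 3 ≤ k →
    (D : Fin (basketSize k) → Fin (basketSize k) → ℕ) →
    (∀ i j → IsDist k (toℕ i) (toℕ j) (D i j)) →
    Σ (Fin (basketSize k) → ℚ) λ x →
      (sumFin x ≡ 1ℚ) ×
      (∀ i → sumFin (λ j → ((+ (D i j)) / 1) * x j) ≡ basketConst k)
lemma2p2 (suc (suc (suc m))) (s≤s (s≤s (s≤s _))) D isDist = x , total , row
  where
  open Basket m
  x : Fin (basketSize k) → ℚ
  x j = weight (decode (toℕ j)) / 2
  total : sumFin x ≡ 1ℚ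
  total = trans (sumFin-halves {basketSize k} (weight ∘ decode)) (cong (_/ 2) (trans (label-sum weight) total-weight))
  row : ∀ i → sumFin (λ j → (+ D i j / 1) * x j) ≡ basketConst k
  row i = begin
    sumFin (λ j → (+ D i j / 1) * x j)
      ≡⟨ sumFin-cong (λ j → trans (integer-*-half (D i j) _) (cong (λ d → (+ d ℤ.* weight (decode (toℕ j))) / 2)
                                (distance-matrix (toℕ<n i) (toℕ<n j) (isDist i j)))) ⟩
    sumFin {basketSize k} (λ j → f (toℕ j) / 2)
      ≡⟨ sumFin-halves {basketSize k} f ⟩
    Σ⟨ basketSize k ⟩ (λ ℓ _ → f ℓ) / 2
      ≡⟨ cong (_/ 2) (label-sum (λ w → + distance (decode (toℕ i)) w ℤ.* weight w)) ⟩
    vertexSum (λ w → + distance (decode (toℕ i)) w ℤ.* weight w) / 2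
      ≡⟨ half≡eighth (vertex-row (decode-valid (toℕ<n i))) ⟩
    basketConst k ∎
    where
    open ≡-Reasoning
    f : ℕ → ℤ
    f ℓ = + distance (decode (toℕ i)) (decode ℓ) ℤ.* weight (decode ℓ)
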